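{- For positive integers $k$ and $t$ and any integer $n > kt$, the Toeplitz graph $G_n\langle t, 2t, \ldots, kt\rangle$ is chordal.
   Context: For integers $1 \le t_1 < \cdots < t_k < n$, the Toeplitz graph $G_n\langle t_1, \ldots, t_k\rangle$ is the simple graph with vertex set $\{1, \ldots, n\}$ in which distinct vertices $i,j$ are adjacent iff $|i-j| \in \{t_1, \ldots, t_k\}$. A graph is chordal if it has no induced cycle of length at least $4$. -}

module Defs where

open import Data.Nat using (ℕ; zero; suc; _+_; _*_; _≤_; _<_; _≥_; ∣_-_∣)
open import Data.Fin using (Fin; toℕ)
open import Data.Product using (Σ; _×_; ∃-syntax; _,_)
open import Relation.Nullary using (¬_)
open import Relation.Binary.PropositionalEquality using (_≡_; _≢_)
open import Function.Definitions using (Injective)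
open import Function.Bundles using (_⇔_)

record Graph (V : Set) : Set₁ where
  field
    Adj       : V → V → Set
    irreflexive : ∀ x → ¬ Adj x x
    symmetric : ∀ x y → Adj x y → Adj y x

-- Vertex i : Fin n represents the vertex  toℕ i + 1  of {1,…,n};
-- differences are unaffected by this shift.
ArithToeplitzAdj : (n k t : ℕ) → Fin n → Fin n → Set
ArithToeplitzAdj n k t i j =
  i ≢ j × (∃[ m ] (1 ≤ m × m ≤ k × ∣ toℕ i - toℕ j ∣ ≡ m * t))

CycAdjacentIdx : (ℓ : ℕ) → Fin ℓ → Fin ℓ → Set
CycAdjacentIdx ℓ a b =
  (suc (toℕ a) ≡ toℕ b) Data.Sum.⊎ (suc (toℕ b) ≡ toℕ a)
  Data.Sum.⊎ (suc (toℕ a) ≡ ℓ × toℕ b ≡ 0)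
  Data.Sum.⊎ (suc (toℕ b) ≡ ℓ × toℕ a ≡ 0)
  where import Data.Sum

InducedCycle : {V : Set} → Graph V → ℕ → Set
InducedCycle {V} G ℓ =
  Σ (Fin ℓ → V) λ v →
    Injective _≡_ _≡_ v ×
    (∀ a b → (Graph.Adj G (v a) (v b) ⇔ CycAdjacentIdx ℓ a b))

Chordal : {V : Set} → Graph V → Set
Chordal G = ∀ ℓ → 4 ≤ ℓ → ¬ InducedCycle G ℓ

ArithToeplitzAdj-irrefl : ∀ n k t x → ¬ ArithToeplitzAdj n k t x x
ArithToeplitzAdj-irrefl n k t x (x≢x , _) = x≢x Relation.Binary.PropositionalEquality.refl
  where import Relation.Binary.PropositionalEquality

ArithToeplitzAdj-sym : ∀ n k t x y → ArithToeplitzAdj n k t x y → ArithToeplitzAdj n k t y x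
ArithToeplitzAdj-sym n k t x y (x≢y , m , 1≤m , m≤k , eq) =
  (λ y≡x → x≢y (sym y≡x)) , m , 1≤m , m≤k ,
  trans (Data.Nat.Properties.∣-∣-comm (toℕ y) (toℕ x)) eq
  where
    open import Relation.Binary.PropositionalEquality using (sym; trans)
    import Data.Nat.Properties

ArithToeplitz : (n k t : ℕ) → Graph (Fin n)
ArithToeplitz n k t = record
  { Adj = ArithToeplitzAdj n k t
  ; irreflexive = ArithToeplitzAdj-irrefl n k t
  ; symmetric = ArithToeplitzAdj-sym n k t
  }

{-# OPTIONS --safe #-}
module Submission where

open import Defs
open import Data.Nat using (ℕ; zero; suc; _+_; _*_; _∸_; ∣_-_∣; _<_; _≤_; z≤n; s≤s)
open import Data.Nat.Properties
  using ( ≤-totalOrder; ≤-trans; <-trans; n<1+n; m<n+m; m≤n⇒m<n∨m≡n; n≢0⇒n>0; ⊔-lub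
        ; m∸n+n≡m; m≤n⇒∣n-m∣≡n∸m; ∣m+n-m+o∣≡∣n-o∣; ∣m-n∣≤m⊔n; ∣m-n∣≡0⇒m≡n
        ; +-comm; *-distribʳ-∣-∣ )
open import Data.Fin using (Fin; toℕ; fromℕ<)
open import Data.Fin.Properties using (toℕ-fromℕ<; fromℕ<-injective; toℕ<n; toℕ-injective)
open import Data.List using (allFin)
import Data.List.Relation.Unary.All as All
open import Data.List.Membership.Propositional.Properties using (∈-allFin)
open import Data.List.Extrema ≤-totalOrder using (argmax; f[xs]≤f[argmax])
open import Data.Product using (_×_; ∃-syntax; _,_)
open import Data.Sum using (_⊎_; inj₁; inj₂)
open import Function.Base using (_∘_)
open import Function.Bundles using (Equivalence)
open import Relation.Nullary using (¬_)
open import Relation.Binary.PropositionalEquality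

-- Every vertex x of the Toeplitz graph sees its smaller neighbours at
-- distances m₁t, m₂t ≤ kt, so two such neighbours lie |m₁ - m₂|t apart and are
-- adjacent themselves. In an induced cycle of length ≥ 4, the vertex with the
-- largest label would then have adjacent cycle-neighbours, i.e. a chord.

m+n≡o+p⇒∣n-p∣≡∣o-m∣ : ∀ m o {n p} → m + n ≡ o + p → ∣ n - p ∣ ≡ ∣ o - m ∣
m+n≡o+p⇒∣n-p∣≡∣o-m∣ m o {n} {p} m+n≡o+p = begin
  ∣ n - p ∣          ≡⟨ ∣m+n-m+o∣≡∣n-o∣ m n p ⟨
  ∣ m + n - m + p ∣  ≡⟨ cong (∣_- m + p ∣) m+n≡o+p ⟩
  ∣ o + p - m + p ∣  ≡⟨ cong₂ ∣_-_∣ (+-comm o p) (+-comm m p) ⟩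
  ∣ p + o - p + m ∣  ≡⟨ ∣m+n-m+o∣≡∣n-o∣ p o m ⟩
  ∣ o - m ∣          ∎
  where open ≡-Reasoning

m,n≤o⇒∣m-n∣≡∣∣o-n∣-∣o-m∣∣ : ∀ {m n o} → m ≤ o → n ≤ o → ∣ m - n ∣ ≡ ∣ ∣ o - n ∣ - ∣ o - m ∣ ∣
m,n≤o⇒∣m-n∣≡∣∣o-n∣-∣o-m∣∣ {m} {n} {o} m≤o n≤o
  rewrite m≤n⇒∣n-m∣≡n∸m m≤o | m≤n⇒∣n-m∣≡n∸m n≤o =
  m+n≡o+p⇒∣n-p∣≡∣o-m∣ (o ∸ m) (o ∸ n) (trans (m∸n+n≡m m≤o) (sym (m∸n+n≡m n≤o)))

CycAdjacentℕ : ℕ → ℕ → ℕ → Set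
CycAdjacentℕ ℓ x y =
  (suc x ≡ y) ⊎ (suc y ≡ x) ⊎ (suc x ≡ ℓ × y ≡ 0) ⊎ (suc y ≡ ℓ × x ≡ 0)

cycle-neighboursℕ : ∀ r x → x < 4 + r →
  ∃[ y ] ∃[ z ] y < 4 + r × z < 4 + r ×
    CycAdjacentℕ (4 + r) x y × CycAdjacentℕ (4 + r) x z ×
    ¬ CycAdjacentℕ (4 + r) y z × y ≢ z
cycle-neighboursℕ r zero _ =
  1 , 3 + r , s≤s (s≤s z≤n) , n<1+n (3 + r) ,
  inj₁ refl , inj₂ (inj₂ (inj₂ (refl , refl))) , not-adjacent , λ ()
  where
  not-adjacent : ¬ CycAdjacentℕ (4 + r) 1 (3 + r)
  not-adjacent (inj₁ ())
  not-adjacent (inj₂ (inj₁ ()))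
  not-adjacent (inj₂ (inj₂ (inj₁ (() , _))))
  not-adjacent (inj₂ (inj₂ (inj₂ (_ , ()))))
cycle-neighboursℕ r (suc x) 1+x<4+r with m≤n⇒m<n∨m≡n 1+x<4+r
... | inj₂ refl =
  2 + r , 0 , m<n+m (2 + r) {2} (s≤s z≤n) , s≤s z≤n ,
  inj₂ (inj₁ refl) , inj₂ (inj₂ (inj₁ (refl , refl))) , not-adjacent , λ ()
  where
  not-adjacent : ¬ CycAdjacentℕ (4 + r) (2 + r) 0
  not-adjacent (inj₁ ())
  not-adjacent (inj₂ (inj₁ ()))
  not-adjacent (inj₂ (inj₂ (inj₁ (() , _))))
  not-adjacent (inj₂ (inj₂ (inj₂ (_ , ()))))
... | inj₁ 2+x<4+r =
  x , 2 + x , <-trans (n<1+n x) 1+x<4+r , 2+x<4+r ,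
  inj₂ (inj₁ refl) , inj₁ refl , not-adjacent , λ ()
  where
  not-adjacent : ¬ CycAdjacentℕ (4 + r) x (2 + x)
  not-adjacent (inj₁ ())
  not-adjacent (inj₂ (inj₁ ()))
  not-adjacent (inj₂ (inj₂ (inj₁ (_ , ()))))
  not-adjacent (inj₂ (inj₂ (inj₂ (() , refl))))

cycle-neighbours : ∀ r (a : Fin (4 + r)) →
  ∃[ b ] ∃[ c ] CycAdjacentIdx (4 + r) a b × CycAdjacentIdx (4 + r) a c ×
    ¬ CycAdjacentIdx (4 + r) b c × b ≢ c
cycle-neighbours r a with cycle-neighboursℕ r (toℕ a) (toℕ<n a)
... | y , z , y< , z< , ab , ac , ¬bc , y≢z =
  fromℕ< y< , fromℕ< z< , ab′ , ac′ , ¬bc′ , y≢z ∘ fromℕ<-injective y z y< z<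
  where
  ab′ : CycAdjacentIdx (4 + r) a (fromℕ< y<)
  ab′ rewrite toℕ-fromℕ< y< = ab
  ac′ : CycAdjacentIdx (4 + r) a (fromℕ< z<)
  ac′ rewrite toℕ-fromℕ< z< = ac
  ¬bc′ : ¬ CycAdjacentIdx (4 + r) (fromℕ< y<) (fromℕ< z<)
  ¬bc′ rewrite toℕ-fromℕ< y< | toℕ-fromℕ< z< = ¬bc

Fin-argmax : ∀ ℓ (f : Fin (suc ℓ) → ℕ) → ∃[ a ] (∀ b → f b ≤ f a)
Fin-argmax ℓ f =
  argmax f Fin.zero (allFin (suc ℓ)) ,
  λ b → All.lookup (f[xs]≤f[argmax] {f = f} Fin.zero (allFin (suc ℓ))) (∈-allFin b)

LowerNeighbourhoodsAreCliques : {V : Set} → Graph V → (V → ℕ) → Set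
LowerNeighbourhoodsAreCliques G rank = ∀ {x y z} → rank y ≤ rank x → rank z ≤ rank x →
  Adj x y → Adj x z → y ≢ z → Adj y z
  where open Graph G

lowerNeighbourhoodsAreCliques⇒chordal : {V : Set} (G : Graph V) (rank : V → ℕ) →
  LowerNeighbourhoodsAreCliques G rank → Chordal G
lowerNeighbourhoodsAreCliques⇒chordal G rank cliques
  .(4 + r) (s≤s (s≤s (s≤s (s≤s {n = r} _)))) (v , v-injective , adj⇔cyc) =
  let a , a-max                   = Fin-argmax (3 + r) (rank ∘ v)
      b , c , ab , ac , ¬bc , b≢c = cycle-neighbours r a
      chord = cliques (a-max b) (a-max c) (from (adj⇔cyc a b) ab) (from (adj⇔cyc a c) ac)
                      (b≢c ∘ v-injective)
  in ¬bc (to (adj⇔cyc b c) chord)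
  where open Equivalence using (to; from)

arithToeplitz-lowerNeighbourhoodsAreCliques : ∀ n k t →
  LowerNeighbourhoodsAreCliques (ArithToeplitz n k t) toℕ
arithToeplitz-lowerNeighbourhoodsAreCliques n k t {x} {y} {z} y≤x z≤x
  (_ , m₁ , _ , m₁≤k , xy) (_ , m₂ , _ , m₂≤k , xz) y≢z =
  y≢z , ∣ m₂ - m₁ ∣ , 1≤∣m₂-m₁∣ , ≤-trans (∣m-n∣≤m⊔n m₂ m₁) (⊔-lub m₂≤k m₁≤k) , distance
  where
  open ≡-Reasoning
  distance : ∣ toℕ y - toℕ z ∣ ≡ ∣ m₂ - m₁ ∣ * t
  distance = begin
    ∣ toℕ y - toℕ z ∣                              ≡⟨ m,n≤o⇒∣m-n∣≡∣∣o-n∣-∣o-m∣∣ y≤x z≤x ⟩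
    ∣ (∣ toℕ x - toℕ z ∣) - (∣ toℕ x - toℕ y ∣) ∣  ≡⟨ cong₂ ∣_-_∣ xz xy ⟩
    ∣ m₂ * t - m₁ * t ∣                            ≡⟨ *-distribʳ-∣-∣ t m₂ m₁ ⟨
    ∣ m₂ - m₁ ∣ * t                                ∎
  1≤∣m₂-m₁∣ : 1 ≤ ∣ m₂ - m₁ ∣
  1≤∣m₂-m₁∣ = n≢0⇒n>0 λ ∣m₂-m₁∣≡0 →
    y≢z (toℕ-injective (∣m-n∣≡0⇒m≡n (trans distance (cong (_* t) ∣m₂-m₁∣≡0))))

proposition11 : (k t n : ℕ) → 1 ≤ k → 1 ≤ t → k * t < n → Chordal (ArithToeplitz n k t)
proposition11 k t n _ _ _ =
  lowerNeighbourhoodsAreCliques⇒chordal (ArithToeplitz n k t) toℕ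
    (arithToeplitz-lowerNeighbourhoodsAreCliques n k t)
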